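{- Let $\alpha:a\to a'$ and $\beta:a'\to a''$ be arrows in a category $\mathfrak S$. If $\alpha$ is amalgamable and $\beta\circ\alpha$ is a Ramsey arrow, then $\alpha$ is a Ramsey arrow.
   Context: Composition $g\circ f$ ($f$ first); $\mathfrak S(\gamma,b):=\{f\circ\gamma:f\in\mathfrak S(c',b)\}$ for $\gamma:c\to c'$. An arrow $\gamma:c\to c'$ is a Ramsey arrow if for every object $b$, $k\in\mathbb N$ and finite $F\subseteq\mathfrak S(\gamma,b)$ there is an object $v$ such that for every $\phi:\mathfrak S(\gamma,v)\to k$ there is $e\in\mathfrak S(b,v)$ with $\phi$ constant on $e\circ F$. An arrow $e:z\to z'$ is amalgamable if for all $f:z'\to x$, $g:z'\to y$ there are $f':x\to w$, $g':y\to w$ with $f'\circ f\circ e=g'\circ g\circ e$. -}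

module Defs where

open import Level using (Level; suc; _⊔_)
open import Data.Nat using (ℕ)
open import Data.Fin using (Fin)
open import Data.Product using (Σ; ∃; ∃-syntax; _×_; _,_)
open import Data.List using (List)
open import Data.List.Relation.Unary.All using (All)
open import Relation.Binary.PropositionalEquality using (_≡_)

record Category (o h : Level) : Set (suc (o ⊔ h)) where
  infixr 9 _∘_
  field
    Obj  : Set o
    Hom  : Obj → Obj → Set h
    id   : ∀ {A} → Hom A A
    _∘_  : ∀ {A B C} → Hom B C → Hom A B → Hom A C
    assoc : ∀ {A B C D} {f : Hom A B} {g : Hom B C} {k : Hom C D} →
            (k ∘ g) ∘ f ≡ k ∘ (g ∘ f)
    identityˡ : ∀ {A B} {f : Hom A B} → id ∘ f ≡ f
    identityʳ : ∀ {A B} {f : Hom A B} → f ∘ id ≡ f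

module _ {o h : Level} (𝓢 : Category o h) where
  open Category 𝓢

  InS : ∀ {c c' b} → Hom c c' → Hom c b → Set h
  InS {c' = c'} {b = b} γ g = ∃[ f ] (g ≡ f ∘ γ)

  Constant : ∀ {A B} {k : ℕ} → (Hom A B → Fin k) → List (Hom A B) → Set h
  Constant {k = k} φ L = ∃[ i ] All (λ x → φ x ≡ i) L

  -- A finite F ⊆ 𝔖(γ,b) is a list of elements of 𝔖(γ,b);
  -- a colouring φ : 𝔖(γ,v) → k is represented by a function on all arrows c → v
  -- (only its values on 𝔖(γ,v) are relevant, and every colouring of 𝔖(γ,v) extends).
  IsRamsey : ∀ {c c'} → Hom c c' → Set (o ⊔ h)
  IsRamsey {c} {c'} γ =
    ∀ (b : Obj) (k : ℕ) (F : List (Hom c b)) → All (InS γ) F →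
    ∃[ v ] ∀ (φ : Hom c v → Fin k) →
      ∃[ e ] Constant φ (Data.List.map (λ x → e ∘ x) F)

  IsAmalgamable : ∀ {z z'} → Hom z z' → Set (o ⊔ h)
  IsAmalgamable {z} {z'} e =
    ∀ {x y} (f : Hom z' x) (g : Hom z' y) →
    ∃[ w ] Σ (Hom x w) λ f' → Σ (Hom y w) λ g' → f' ∘ f ∘ e ≡ g' ∘ g ∘ e

module Submission where

-- If α is amalgamable, every finite F ⊆ 𝔖(α,b) is carried by a single arrow
-- p : b → d into 𝔖(β∘α,d): amalgamating the factor of each element with β
-- lands it in 𝔖(β∘α,·), and the amalgamations are stacked one after another.
-- A colouring of 𝔖(α,v) restricts to 𝔖(β∘α,v) ⊆ 𝔖(α,v), so the Ramsey witness
-- e for p∘F gives the witness e∘p for F.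

open import Defs
open import Level using (Level; _⊔_)
open import Data.Fin using (Fin)
open import Data.Product using (Σ; ∃-syntax; _,_)
open import Data.List using (List; []; _∷_; map)
open import Data.List.Relation.Unary.All using (All; []; _∷_)
import Data.List.Relation.Unary.All as All
open import Data.List.Relation.Unary.All.Properties using (map⁺; map⁻)
open import Relation.Binary.PropositionalEquality using (sym; trans; cong; subst; module ≡-Reasoning)

module _ {o h : Level} (𝓢 : Category o h) where
  open Category 𝓢

  InS-∘ˡ : ∀ {c c' b d} {γ : Hom c c'} {g : Hom c b} (p : Hom b d) →
           InS 𝓢 γ g → InS 𝓢 γ (p ∘ g)
  InS-∘ˡ {γ = γ} {g} p (f , g≡f∘γ) = p ∘ f , (begin
    p ∘ g        ≡⟨ cong (p ∘_) g≡f∘γ ⟩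
    p ∘ (f ∘ γ)  ≡⟨ sym assoc ⟩
    (p ∘ f) ∘ γ  ∎)
    where open ≡-Reasoning

  PushesInto : ∀ {c c' c''} → Hom c c' → Hom c c'' → Set (o ⊔ h)
  PushesInto {c} γ δ = ∀ {b} (F : List (Hom c b)) → All (InS 𝓢 γ) F →
    ∃[ d ] Σ (Hom b d) λ p → All (InS 𝓢 δ) (map (p ∘_) F)

  constant-map-∘ : ∀ {A B C D} {k} (φ : Hom A D → Fin k) (e : Hom C D) (p : Hom B C)
    (F : List (Hom A B)) →
    Constant 𝓢 φ (map (e ∘_) (map (p ∘_) F)) →
    Constant 𝓢 φ (map ((e ∘ p) ∘_) F)
  constant-map-∘ φ e p F (i , φ≡i) =
    i , map⁺ (All.map (trans (cong φ assoc)) (map⁻ (map⁻ φ≡i)))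

  isRamsey-pushesInto : ∀ {c c' c''} {γ : Hom c c'} {δ : Hom c c''} →
    PushesInto γ δ → IsRamsey 𝓢 δ → IsRamsey 𝓢 γ
  isRamsey-pushesInto push ramsey b k F F⊆𝔖γ with push F F⊆𝔖γ
  ... | d , p , pF⊆𝔖δ with ramsey d k (map (p ∘_) F) pF⊆𝔖δ
  ... | v , homogeneous = v , λ φ → witness φ (homogeneous φ)
    where
    witness : ∀ φ → ∃[ e ] Constant 𝓢 φ (map (e ∘_) (map (p ∘_) F)) →
              ∃[ e ] Constant 𝓢 φ (map (e ∘_) F)
    witness φ (e , const) = e ∘ p , constant-map-∘ φ e p F const

  amalgamate-into-∘ : ∀ {a a' a'' b} {α : Hom a a'} (β : Hom a' a'') →
    IsAmalgamable 𝓢 α → (g : Hom a b) → InS 𝓢 α g →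
    ∃[ w ] Σ (Hom b w) λ q → InS 𝓢 (β ∘ α) (q ∘ g)
  amalgamate-into-∘ {α = α} β amalgamable g (f , g≡f∘α)
    with amalgamable f β
  ... | w , f' , g' , f'∘f∘α≡g'∘β∘α = w , f' , g' , (begin
    f' ∘ g        ≡⟨ cong (f' ∘_) g≡f∘α ⟩
    f' ∘ (f ∘ α)  ≡⟨ f'∘f∘α≡g'∘β∘α ⟩
    g' ∘ (β ∘ α)  ∎)
    where open ≡-Reasoning

  amalgamable-pushesInto-∘ : ∀ {a a' a''} {α : Hom a a'} (β : Hom a' a'') →
    IsAmalgamable 𝓢 α → PushesInto α (β ∘ α)
  amalgamable-pushesInto-∘ β amalgamable [] [] = _ , id , []
  amalgamable-pushesInto-∘ β amalgamable (x ∷ F) (x∈𝔖α ∷ F⊆𝔖α)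
    with amalgamable-pushesInto-∘ β amalgamable F F⊆𝔖α
  ... | d , p , pF⊆𝔖βα
    with amalgamate-into-∘ β amalgamable (p ∘ x) (InS-∘ˡ p x∈𝔖α)
  ... | w , q , q∘p∘x∈𝔖βα =
    w , q ∘ p ,
    subst (InS 𝓢 _) (sym assoc) q∘p∘x∈𝔖βα ∷
    map⁺ (All.map (λ p∘y∈𝔖βα → subst (InS 𝓢 _) (sym assoc) (InS-∘ˡ q p∘y∈𝔖βα))
                  (map⁻ pF⊆𝔖βα))

mainTheorem16 : ∀ {o h : Level} (𝓢 : Category o h) {a a' a'' : Category.Obj 𝓢}
    (α : Category.Hom 𝓢 a a') (β : Category.Hom 𝓢 a' a'') →
    IsAmalgamable 𝓢 α → IsRamsey 𝓢 (Category._∘_ 𝓢 β α) → IsRamsey 𝓢 α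
mainTheorem16 𝓢 α β amalgamable =
  isRamsey-pushesInto 𝓢 (amalgamable-pushesInto-∘ 𝓢 β amalgamable)
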